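{- Let $p:\mathcal E\to\mathcal I$ be a monoidal closed fibration. Let $T\sqsubset B$ and $U\sqsubset C$ be e-types, let $f:C'\to C$ be any expression, and let $V=f^{*}U\sqsubset C'$ be a pullback of $U$ along $f$. Then the subtyping judgment $$\mathrm{shift}_{B,C}^{*}\big((U/T)\backslash U\big)\;\le\;\mathrm{shift}_{B,C'}^{*}\big((V/T)\backslash V\big)$$ is derivable.
   Context: A type refinement system is a functor $p:\mathcal E\to\mathcal I$; objects/morphisms of $\mathcal I$ are i-types/expressions, of $\mathcal E$ are e-types/derivations; composition is diagrammatic. $S\sqsubset A$ means $p(S)=A$. A derivation of $S\Rightarrow_f T$ is a morphism $\alpha:S\to T$ of $\mathcal E$ with $p(\alpha)=f$; derivable means one exists; $S\le T$ denotes $S\Rightarrow_{\mathrm{id}}T$. For $f:A\to B$, $T\sqsubset B$, a pullback $f^*T\sqsubset A$ is an e-type with a cartesian derivation of $f^*T\Rightarrow_f T$ (every derivation of $S\Rightarrow_{g;f}T$ factors uniquely through it via a derivation of $S\Rightarrow_g f^*T$); a fibration has all pullbacks. $\mathcal I$ is monoidal closed with product $\otimes$, left residuals $A\backslash C$ (evaluation $\mathrm{ev}^l:A\otimes(A\backslash C)\to C$, currying bijection $\lambda:\mathrm{Hom}(A\otimes X,C)\cong\mathrm{Hom}(X,A\backslash C)$) and right residuals $C/B$ (evaluation $\mathrm{ev}^r:(C/B)\otimes B\to C$, currying bijection $\rho:\mathrm{Hom}(X\otimes B,C)\cong\mathrm{Hom}(X,C/B)$), with the usual $\beta\eta$ equations.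 $\mathrm{shift}_{B,C}:=\lambda(\mathrm{ev}^r):B\to (C/B)\backslash C$. A monoidal closed fibration is a fibration $p$ which is a strong monoidal functor ($S\otimes T\sqsubset A\otimes B$ when $S\sqsubset A,T\sqsubset B$), whose $\otimes$ preserves pullbacks, and which has, for all $S\sqsubset A$, $T\sqsubset B$, $U\sqsubset C$, e-types $S\backslash U\sqsubset A\backslash C$ and $U/T\sqsubset C/B$ with derivations of $S\otimes(S\backslash U)\Rightarrow_{\mathrm{ev}^l}U$ and $(U/T)\otimes T\Rightarrow_{\mathrm{ev}^r}U$ and operations sending derivations of $S\otimes X\Rightarrow_g U$ to derivations of $X\Rightarrow_{\lambda g}S\backslash U$, and derivations of $X\otimes T\Rightarrow_g U$ to derivations of $X\Rightarrow_{\rho g}U/T$, satisfying the $\beta\eta$ equations lying over those of $\mathcal I$. -}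

module Defs where

-- Type refinement systems, presented in "displayed" form:
-- a functor p : E → I is given by, for each i-type A, the type  Ob[ A ]  of
-- e-types S ⊏ A, and for each expression f : A → B and S ⊏ A, T ⊏ B, the type
-- Hom[ f ] S T  of derivations of  S ⇒_f T.  (E is the total category; p the
-- projection.)  Composition is diagrammatic (_⨾_).

open import Level using (Level; _⊔_) renaming (suc to lsuc)
open import Relation.Binary.PropositionalEquality using (_≡_; subst)
open import Data.Product using (Σ; _×_)

PathOver : ∀ {a b} {X : Set a} (P : X → Set b) {x y : X} →
           P x → x ≡ y → P y → Set b
PathOver P p e q = subst P e p ≡ q

record Category (o h : Level) : Set (lsuc (o ⊔ h)) where
  infixr 9 _⨾_
  field
    Obj  : Set o
    Hom  : Obj → Obj → Set h
    id   : ∀ {A} → Hom A A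
    _⨾_  : ∀ {A B C} → Hom A B → Hom B C → Hom A C
    idˡ   : ∀ {A B} {f : Hom A B} → id ⨾ f ≡ f
    idʳ   : ∀ {A B} {f : Hom A B} → f ⨾ id ≡ f
    assoc : ∀ {A B C D} {f : Hom A B} {g : Hom B C} {k : Hom C D} →
            (f ⨾ g) ⨾ k ≡ f ⨾ (g ⨾ k)

record Monoidal {o h} (𝒞 : Category o h) : Set (o ⊔ h) where
  open Category 𝒞
  infixr 10 _⊗₀_ _⊗₁_
  field
    _⊗₀_ : Obj → Obj → Obj
    _⊗₁_ : ∀ {A B A' B'} → Hom A B → Hom A' B' → Hom (A ⊗₀ A') (B ⊗₀ B')
    ⊗-id : ∀ {A B} → id {A} ⊗₁ id {B} ≡ id
    ⊗-⨾  : ∀ {A B C A' B' C'} {f : Hom A B} {g : Hom B C}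
             {f' : Hom A' B'} {g' : Hom B' C'} →
           (f ⨾ g) ⊗₁ (f' ⨾ g') ≡ (f ⊗₁ f') ⨾ (g ⊗₁ g')
    𝟙    : Obj
    assoc⇒ : ∀ {A B C} → Hom ((A ⊗₀ B) ⊗₀ C) (A ⊗₀ (B ⊗₀ C))
    assoc⇐ : ∀ {A B C} → Hom (A ⊗₀ (B ⊗₀ C)) ((A ⊗₀ B) ⊗₀ C)
    assoc-iso₁ : ∀ {A B C} → assoc⇒ {A} {B} {C} ⨾ assoc⇐ ≡ id
    assoc-iso₂ : ∀ {A B C} → assoc⇐ {A} {B} {C} ⨾ assoc⇒ ≡ id
    assoc-nat  : ∀ {A B C A' B' C'} {f : Hom A A'} {g : Hom B B'} {k : Hom C C'} →
                 ((f ⊗₁ g) ⊗₁ k) ⨾ assoc⇒ ≡ assoc⇒ ⨾ (f ⊗₁ (g ⊗₁ k))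
    unitˡ⇒ : ∀ {A} → Hom (𝟙 ⊗₀ A) A
    unitˡ⇐ : ∀ {A} → Hom A (𝟙 ⊗₀ A)
    unitˡ-iso₁ : ∀ {A} → unitˡ⇒ {A} ⨾ unitˡ⇐ ≡ id
    unitˡ-iso₂ : ∀ {A} → unitˡ⇐ {A} ⨾ unitˡ⇒ ≡ id
    unitˡ-nat  : ∀ {A B} {f : Hom A B} → (id ⊗₁ f) ⨾ unitˡ⇒ ≡ unitˡ⇒ ⨾ f
    unitʳ⇒ : ∀ {A} → Hom (A ⊗₀ 𝟙) A
    unitʳ⇐ : ∀ {A} → Hom A (A ⊗₀ 𝟙)
    unitʳ-iso₁ : ∀ {A} → unitʳ⇒ {A} ⨾ unitʳ⇐ ≡ id
    unitʳ-iso₂ : ∀ {A} → unitʳ⇐ {A} ⨾ unitʳ⇒ ≡ id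
    unitʳ-nat  : ∀ {A B} {f : Hom A B} → (f ⊗₁ id) ⨾ unitʳ⇒ ≡ unitʳ⇒ ⨾ f
    pentagon : ∀ {A B C D} →
      ((assoc⇒ {A} {B} {C} ⊗₁ id {D}) ⨾ assoc⇒) ⨾ (id ⊗₁ assoc⇒)
        ≡ assoc⇒ ⨾ assoc⇒
    triangle : ∀ {A B} →
      assoc⇒ ⨾ (id {A} ⊗₁ unitˡ⇒ {B}) ≡ unitʳ⇒ ⊗₁ id

record Closed {o h} {𝒞 : Category o h} (ℳ : Monoidal 𝒞) : Set (o ⊔ h) where
  open Category 𝒞
  open Monoidal ℳ
  field
    _⧹_    : Obj → Obj → Obj
    evˡ    : ∀ {A C} → Hom (A ⊗₀ (A ⧹ C)) C
    curryˡ : ∀ {A X C} → Hom (A ⊗₀ X) C → Hom X (A ⧹ C)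
    βˡ     : ∀ {A X C} {g : Hom (A ⊗₀ X) C} → (id ⊗₁ curryˡ g) ⨾ evˡ ≡ g
    ηˡ     : ∀ {A X C} {k : Hom X (A ⧹ C)} → curryˡ ((id ⊗₁ k) ⨾ evˡ) ≡ k
    _⧸_    : Obj → Obj → Obj
    evʳ    : ∀ {C B} → Hom ((C ⧸ B) ⊗₀ B) C
    curryʳ : ∀ {X B C} → Hom (X ⊗₀ B) C → Hom X (C ⧸ B)
    βʳ     : ∀ {X B C} {g : Hom (X ⊗₀ B) C} → (curryʳ g ⊗₁ id) ⨾ evʳ ≡ g
    ηʳ     : ∀ {X B C} {k : Hom X (C ⧸ B)} → curryʳ ((k ⊗₁ id) ⨾ evʳ) ≡ k

  shift : ∀ B C → Hom B ((C ⧸ B) ⧹ C)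
  shift B C = curryˡ (evʳ {C} {B})

record MonoidalClosedCategory (o h : Level) : Set (lsuc (o ⊔ h)) where
  field
    cat    : Category o h
    mon    : Monoidal cat
    closed : Closed mon
  open Category cat public
  open Monoidal mon public
  open Closed closed public

record Displayed {o h} (𝒞 : Category o h) (o' h' : Level)
       : Set (o ⊔ h ⊔ lsuc (o' ⊔ h')) where
  open Category 𝒞
  infixr 9 _⨾ᴰ_
  field
    Ob[_]  : Obj → Set o'
    Hom[_] : ∀ {A B} → Hom A B → Ob[ A ] → Ob[ B ] → Set h'
    idᴰ    : ∀ {A} {S : Ob[ A ]} → Hom[ id ] S S
    _⨾ᴰ_   : ∀ {A B C} {f : Hom A B} {g : Hom B C}
               {S : Ob[ A ]} {T : Ob[ B ]} {U : Ob[ C ]} →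
             Hom[ f ] S T → Hom[ g ] T U → Hom[ f ⨾ g ] S U
    idᴰˡ   : ∀ {A B} {f : Hom A B} {S T} {α : Hom[ f ] S T} →
             PathOver (λ k → Hom[ k ] S T) (idᴰ ⨾ᴰ α) idˡ α
    idᴰʳ   : ∀ {A B} {f : Hom A B} {S T} {α : Hom[ f ] S T} →
             PathOver (λ k → Hom[ k ] S T) (α ⨾ᴰ idᴰ) idʳ α
    assocᴰ : ∀ {A B C D} {f : Hom A B} {g : Hom B C} {k : Hom C D}
               {S T U W} {α : Hom[ f ] S T} {β : Hom[ g ] T U} {γ : Hom[ k ] U W} →
             PathOver (λ m → Hom[ m ] S W) ((α ⨾ᴰ β) ⨾ᴰ γ) assoc (α ⨾ᴰ (β ⨾ᴰ γ))

module _ {o h o' h'} {𝒞 : Category o h} (𝒟 : Displayed 𝒞 o' h') where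
  open Category 𝒞
  open Displayed 𝒟

  IsCartesian : ∀ {A B} {f : Hom A B} {S : Ob[ A ]} {T : Ob[ B ]} →
                Hom[ f ] S T → Set (o ⊔ h ⊔ o' ⊔ h')
  IsCartesian {A} {B} {f} {S} {T} φ =
    ∀ {A'} (g : Hom A' A) {S' : Ob[ A' ]} (ψ : Hom[ g ⨾ f ] S' T) →
    Σ (Hom[ g ] S' S) λ χ → (χ ⨾ᴰ φ ≡ ψ) × (∀ χ' → χ' ⨾ᴰ φ ≡ ψ → χ' ≡ χ)

  record Pullback {A B} (f : Hom A B) (T : Ob[ B ]) : Set (o ⊔ h ⊔ o' ⊔ h') where
    field
      obj    : Ob[ A ]
      cart   : Hom[ f ] obj T
      isCart : IsCartesian cart

  Fibration : Set (o ⊔ h ⊔ o' ⊔ h')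
  Fibration = ∀ {A B} (f : Hom A B) (T : Ob[ B ]) → Pullback f T

  _≤_ : ∀ {A} → Ob[ A ] → Ob[ A ] → Set h'
  S ≤ T = Hom[ id ] S T

-- p strong monoidal with S ⊗ T ⊏ A ⊗ B: E is monoidal with all its
-- structure lying over that of I (so p preserves it on the nose).
record MonoidalDisplayed {o h o' h'} {𝒞 : Category o h} (ℳ : Monoidal 𝒞)
       (𝒟 : Displayed 𝒞 o' h') : Set (o ⊔ h ⊔ o' ⊔ h') where
  open Category 𝒞
  open Monoidal ℳ
  open Displayed 𝒟
  infixr 10 _⊗ᴰ₀_ _⊗ᴰ₁_
  field
    _⊗ᴰ₀_ : ∀ {A B} → Ob[ A ] → Ob[ B ] → Ob[ A ⊗₀ B ]
    _⊗ᴰ₁_ : ∀ {A B A' B'} {f : Hom A B} {f' : Hom A' B'}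
              {S T S' T'} →
            Hom[ f ] S T → Hom[ f' ] S' T' → Hom[ f ⊗₁ f' ] (S ⊗ᴰ₀ S') (T ⊗ᴰ₀ T')
    ⊗ᴰ-id : ∀ {A B} {S : Ob[ A ]} {T : Ob[ B ]} →
            PathOver (λ k → Hom[ k ] (S ⊗ᴰ₀ T) (S ⊗ᴰ₀ T)) (idᴰ ⊗ᴰ₁ idᴰ) ⊗-id idᴰ
    ⊗ᴰ-⨾  : ∀ {A B C A' B' C'} {f : Hom A B} {g : Hom B C}
              {f' : Hom A' B'} {g' : Hom B' C'} {S T U S' T' U'}
              {α : Hom[ f ] S T} {β : Hom[ g ] T U}
              {α' : Hom[ f' ] S' T'} {β' : Hom[ g' ] T' U'} →
            PathOver (λ k → Hom[ k ] (S ⊗ᴰ₀ S') (U ⊗ᴰ₀ U'))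
              ((α ⨾ᴰ β) ⊗ᴰ₁ (α' ⨾ᴰ β')) ⊗-⨾ ((α ⊗ᴰ₁ α') ⨾ᴰ (β ⊗ᴰ₁ β'))
    𝟙ᴰ : Ob[ 𝟙 ]
    assocᴰ⇒ : ∀ {A B C} {S : Ob[ A ]} {T : Ob[ B ]} {U : Ob[ C ]} →
              Hom[ assoc⇒ ] ((S ⊗ᴰ₀ T) ⊗ᴰ₀ U) (S ⊗ᴰ₀ (T ⊗ᴰ₀ U))
    assocᴰ⇐ : ∀ {A B C} {S : Ob[ A ]} {T : Ob[ B ]} {U : Ob[ C ]} →
              Hom[ assoc⇐ ] (S ⊗ᴰ₀ (T ⊗ᴰ₀ U)) ((S ⊗ᴰ₀ T) ⊗ᴰ₀ U)
    assocᴰ-iso₁ : ∀ {A B C} {S : Ob[ A ]} {T : Ob[ B ]} {U : Ob[ C ]} →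
                  PathOver (λ k → Hom[ k ] ((S ⊗ᴰ₀ T) ⊗ᴰ₀ U) ((S ⊗ᴰ₀ T) ⊗ᴰ₀ U))
                    (assocᴰ⇒ {S = S} {T} {U} ⨾ᴰ assocᴰ⇐) assoc-iso₁ idᴰ
    assocᴰ-iso₂ : ∀ {A B C} {S : Ob[ A ]} {T : Ob[ B ]} {U : Ob[ C ]} →
                  PathOver (λ k → Hom[ k ] (S ⊗ᴰ₀ (T ⊗ᴰ₀ U)) (S ⊗ᴰ₀ (T ⊗ᴰ₀ U)))
                    (assocᴰ⇐ {S = S} {T} {U} ⨾ᴰ assocᴰ⇒) assoc-iso₂ idᴰ
    assocᴰ-nat : ∀ {A B C A' B' C'} {f : Hom A A'} {g : Hom B B'} {k : Hom C C'}
                   {S S' T T' U U'}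
                   {α : Hom[ f ] S S'} {β : Hom[ g ] T T'} {γ : Hom[ k ] U U'} →
                 PathOver (λ m → Hom[ m ] ((S ⊗ᴰ₀ T) ⊗ᴰ₀ U) (S' ⊗ᴰ₀ (T' ⊗ᴰ₀ U')))
                   (((α ⊗ᴰ₁ β) ⊗ᴰ₁ γ) ⨾ᴰ assocᴰ⇒) assoc-nat
                   (assocᴰ⇒ ⨾ᴰ (α ⊗ᴰ₁ (β ⊗ᴰ₁ γ)))
    unitᴰˡ⇒ : ∀ {A} {S : Ob[ A ]} → Hom[ unitˡ⇒ ] (𝟙ᴰ ⊗ᴰ₀ S) S
    unitᴰˡ⇐ : ∀ {A} {S : Ob[ A ]} → Hom[ unitˡ⇐ ] S (𝟙ᴰ ⊗ᴰ₀ S)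
    unitᴰˡ-iso₁ : ∀ {A} {S : Ob[ A ]} →
                  PathOver (λ k → Hom[ k ] (𝟙ᴰ ⊗ᴰ₀ S) (𝟙ᴰ ⊗ᴰ₀ S)) (unitᴰˡ⇒ {S = S} ⨾ᴰ unitᴰˡ⇐) unitˡ-iso₁ idᴰ
    unitᴰˡ-iso₂ : ∀ {A} {S : Ob[ A ]} →
                  PathOver (λ k → Hom[ k ] S S) (unitᴰˡ⇐ {S = S} ⨾ᴰ unitᴰˡ⇒) unitˡ-iso₂ idᴰ
    unitᴰˡ-nat  : ∀ {A B} {f : Hom A B} {S T} {α : Hom[ f ] S T} →
                  PathOver (λ k → Hom[ k ] (𝟙ᴰ ⊗ᴰ₀ S) T)
                    ((idᴰ {S = 𝟙ᴰ} ⊗ᴰ₁ α) ⨾ᴰ unitᴰˡ⇒) unitˡ-nat (unitᴰˡ⇒ ⨾ᴰ α)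
    unitᴰʳ⇒ : ∀ {A} {S : Ob[ A ]} → Hom[ unitʳ⇒ ] (S ⊗ᴰ₀ 𝟙ᴰ) S
    unitᴰʳ⇐ : ∀ {A} {S : Ob[ A ]} → Hom[ unitʳ⇐ ] S (S ⊗ᴰ₀ 𝟙ᴰ)
    unitᴰʳ-iso₁ : ∀ {A} {S : Ob[ A ]} →
                  PathOver (λ k → Hom[ k ] (S ⊗ᴰ₀ 𝟙ᴰ) (S ⊗ᴰ₀ 𝟙ᴰ)) (unitᴰʳ⇒ {S = S} ⨾ᴰ unitᴰʳ⇐) unitʳ-iso₁ idᴰ
    unitᴰʳ-iso₂ : ∀ {A} {S : Ob[ A ]} →
                  PathOver (λ k → Hom[ k ] S S) (unitᴰʳ⇐ {S = S} ⨾ᴰ unitᴰʳ⇒) unitʳ-iso₂ idᴰ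
    unitᴰʳ-nat  : ∀ {A B} {f : Hom A B} {S T} {α : Hom[ f ] S T} →
                  PathOver (λ k → Hom[ k ] (S ⊗ᴰ₀ 𝟙ᴰ) T)
                    ((α ⊗ᴰ₁ idᴰ {S = 𝟙ᴰ}) ⨾ᴰ unitᴰʳ⇒) unitʳ-nat (unitᴰʳ⇒ ⨾ᴰ α)
    pentagonᴰ : ∀ {A B C D} {S : Ob[ A ]} {T : Ob[ B ]} {U : Ob[ C ]} {W : Ob[ D ]} →
                PathOver (λ k → Hom[ k ] (((S ⊗ᴰ₀ T) ⊗ᴰ₀ U) ⊗ᴰ₀ W) (S ⊗ᴰ₀ (T ⊗ᴰ₀ (U ⊗ᴰ₀ W))))
                  (((assocᴰ⇒ {S = S} {T} {U} ⊗ᴰ₁ idᴰ {S = W}) ⨾ᴰ assocᴰ⇒)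
                     ⨾ᴰ (idᴰ ⊗ᴰ₁ assocᴰ⇒))
                  pentagon (assocᴰ⇒ ⨾ᴰ assocᴰ⇒)
    triangleᴰ : ∀ {A B} {S : Ob[ A ]} {T : Ob[ B ]} →
                PathOver (λ k → Hom[ k ] ((S ⊗ᴰ₀ 𝟙ᴰ) ⊗ᴰ₀ T) (S ⊗ᴰ₀ T))
                  (assocᴰ⇒ ⨾ᴰ (idᴰ {S = S} ⊗ᴰ₁ unitᴰˡ⇒ {S = T}))
                  triangle (unitᴰʳ⇒ ⊗ᴰ₁ idᴰ)

record ClosedDisplayed {o h o' h'} {𝒞 : Category o h} {ℳ : Monoidal 𝒞}
       (𝒦 : Closed ℳ) {𝒟 : Displayed 𝒞 o' h'} (ℳᴰ : MonoidalDisplayed ℳ 𝒟)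
       : Set (o ⊔ h ⊔ o' ⊔ h') where
  open Category 𝒞
  open Monoidal ℳ
  open Closed 𝒦
  open Displayed 𝒟
  open MonoidalDisplayed ℳᴰ
  field
    _⧹ᴰ_    : ∀ {A C} → Ob[ A ] → Ob[ C ] → Ob[ A ⧹ C ]
    evᴰˡ    : ∀ {A C} {S : Ob[ A ]} {U : Ob[ C ]} →
              Hom[ evˡ ] (S ⊗ᴰ₀ (S ⧹ᴰ U)) U
    curryᴰˡ : ∀ {A X C} {g : Hom (A ⊗₀ X) C} {S : Ob[ A ]} {Y : Ob[ X ]} {U : Ob[ C ]} →
              Hom[ g ] (S ⊗ᴰ₀ Y) U → Hom[ curryˡ g ] Y (S ⧹ᴰ U)
    βᴰˡ     : ∀ {A X C} {g : Hom (A ⊗₀ X) C} {S : Ob[ A ]} {Y : Ob[ X ]} {U : Ob[ C ]}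
                {α : Hom[ g ] (S ⊗ᴰ₀ Y) U} →
              PathOver (λ k → Hom[ k ] (S ⊗ᴰ₀ Y) U) ((idᴰ ⊗ᴰ₁ curryᴰˡ α) ⨾ᴰ evᴰˡ) βˡ α
    ηᴰˡ     : ∀ {A X C} {k : Hom X (A ⧹ C)} {S : Ob[ A ]} {Y : Ob[ X ]} {U : Ob[ C ]}
                {χ : Hom[ k ] Y (S ⧹ᴰ U)} →
              PathOver (λ m → Hom[ m ] Y (S ⧹ᴰ U)) (curryᴰˡ ((idᴰ ⊗ᴰ₁ χ) ⨾ᴰ evᴰˡ)) ηˡ χ
    _⧸ᴰ_    : ∀ {C B} → Ob[ C ] → Ob[ B ] → Ob[ C ⧸ B ]
    evᴰʳ    : ∀ {C B} {U : Ob[ C ]} {T : Ob[ B ]} →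
              Hom[ evʳ ] ((U ⧸ᴰ T) ⊗ᴰ₀ T) U
    curryᴰʳ : ∀ {X B C} {g : Hom (X ⊗₀ B) C} {Y : Ob[ X ]} {T : Ob[ B ]} {U : Ob[ C ]} →
              Hom[ g ] (Y ⊗ᴰ₀ T) U → Hom[ curryʳ g ] Y (U ⧸ᴰ T)
    βᴰʳ     : ∀ {X B C} {g : Hom (X ⊗₀ B) C} {Y : Ob[ X ]} {T : Ob[ B ]} {U : Ob[ C ]}
                {α : Hom[ g ] (Y ⊗ᴰ₀ T) U} →
              PathOver (λ k → Hom[ k ] (Y ⊗ᴰ₀ T) U) ((curryᴰʳ α ⊗ᴰ₁ idᴰ) ⨾ᴰ evᴰʳ) βʳ α
    ηᴰʳ     : ∀ {X B C} {k : Hom X (C ⧸ B)} {Y : Ob[ X ]} {T : Ob[ B ]} {U : Ob[ C ]}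
                {χ : Hom[ k ] Y (U ⧸ᴰ T)} →
              PathOver (λ m → Hom[ m ] Y (U ⧸ᴰ T)) (curryᴰʳ ((χ ⊗ᴰ₁ idᴰ) ⨾ᴰ evᴰʳ)) ηʳ χ

record MonoidalClosedFibration {o h} (𝕀 : MonoidalClosedCategory o h) (o' h' : Level)
       : Set (o ⊔ h ⊔ lsuc (o' ⊔ h')) where
  open MonoidalClosedCategory 𝕀 using (cat; mon; closed)
  field
    disp       : Displayed cat o' h'
    fibration  : Fibration disp
    monᴰ       : MonoidalDisplayed mon disp
    ⊗-pres-cart : ∀ {A B A' B'} {f : Category.Hom cat A B} {f' : Category.Hom cat A' B'}
                    {S T S' T'} {φ : Displayed.Hom[_] disp f S T}
                    {φ' : Displayed.Hom[_] disp f' S' T'} →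
                  IsCartesian disp φ → IsCartesian disp φ' →
                  IsCartesian disp (MonoidalDisplayed._⊗ᴰ₁_ monᴰ φ φ')
    closedᴰ    : ClosedDisplayed closed monᴰ
  open Displayed disp public
  open MonoidalDisplayed monᴰ public
  open ClosedDisplayed closedᴰ public

  _* : ∀ {A B} (f : Category.Hom cat A B) → Ob[ B ] → Ob[ A ]
  (f *) T = Pullback.obj (fibration f T)

module Submission where

-- Write W = shift_{B,C}^* ((U/T)\U), with cartesian derivation
-- c : W ⇒_{shift_{B,C}} (U/T)\U, and let V = f^* U with cartesian
-- derivation v : V ⇒_f U.  Any derivation over shift_{B,C'} into
-- (V/T)\V factors through the pullback along shift_{B,C'} as a derivation
-- over the identity, i.e. a subtyping W ≤ shift_{B,C'}^*((V/T)\V).  By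
-- currying it suffices to derive (V/T) ⊗ W ⇒_{ev^r} V, and since V is a
-- pullback of U along f it suffices to derive (V/T) ⊗ W ⇒_{ev^r;f} U.
-- That derivation is obtained by turning v into V/T ⇒ U/T (postcomposition
-- under the right residual) and then evaluating the shifted argument W via c;
-- the β-laws of I show that the expression underneath is exactly ev^r;f.

open import Level using (Level)
open import Defs
open import Relation.Binary.PropositionalEquality
  using (_≡_; sym; cong; subst; module ≡-Reasoning)
open import Data.Product using (proj₁)

module PullbackFactorisation {o h o' h' : Level} {𝒞 : Category o h}
    (𝒟 : Displayed 𝒞 o' h') where
  open Category 𝒞
  open Displayed 𝒟

  reindex : ∀ {A B} {f g : Hom A B} {S : Ob[ A ]} {T : Ob[ B ]} →
            f ≡ g → Hom[ f ] S T → Hom[ g ] S T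
  reindex {S = S} {T} e α = subst (λ k → Hom[ k ] S T) e α

  factorThrough : ∀ {A A' B} {f : Hom A B} {T : Ob[ B ]} (P : Pullback 𝒟 f T)
                  (g : Hom A' A) {S : Ob[ A' ]} →
                  Hom[ g ⨾ f ] S T → Hom[ g ] S (Pullback.obj P)
  factorThrough P g ψ = proj₁ (Pullback.isCart P g ψ)

  subtypeOfPullback : ∀ {A B} {f : Hom A B} {T : Ob[ B ]} (P : Pullback 𝒟 f T)
                      {S : Ob[ A ]} →
                      Hom[ f ] S T → _≤_ 𝒟 S (Pullback.obj P)
  subtypeOfPullback P ψ = factorThrough P id (reindex (sym idˡ) ψ)

module Residuals {o h o' h' : Level}
    (𝕀 : MonoidalClosedCategory o h) (𝔼 : MonoidalClosedFibration 𝕀 o' h') where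
  open MonoidalClosedCategory 𝕀
  open MonoidalClosedFibration 𝔼
  open PullbackFactorisation disp using (reindex)

  postcompose⧸ : ∀ {B C C'} {f : Hom C' C} {V : Ob[ C' ]} {U : Ob[ C ]}
                 (T : Ob[ B ]) →
                 Hom[ f ] V U → Hom[ curryʳ (evʳ ⨾ f) ] (V ⧸ᴰ T) (U ⧸ᴰ T)
  postcompose⧸ T v = curryᴰʳ (evᴰʳ ⨾ᴰ v)

  evalShift : ∀ {X B C} (g : Hom (X ⊗₀ B) C) →
              (curryʳ g ⊗₁ id) ⨾ ((id ⊗₁ shift B C) ⨾ evˡ) ≡ g
  evalShift {B = B} {C} g = begin
    (curryʳ g ⊗₁ id) ⨾ ((id ⊗₁ curryˡ evʳ) ⨾ evˡ)
      ≡⟨ cong ((curryʳ g ⊗₁ id) ⨾_) βˡ ⟩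
    (curryʳ g ⊗₁ id) ⨾ evʳ
      ≡⟨ βʳ ⟩
    g ∎
    where open ≡-Reasoning

  evalShiftᴰ : ∀ {X B C} {g : Hom (X ⊗₀ B) C} {R : Ob[ X ]} {W : Ob[ B ]}
               {T : Ob[ B ]} {U : Ob[ C ]} →
               Hom[ shift B C ] W ((U ⧸ᴰ T) ⧹ᴰ U) →
               Hom[ curryʳ g ] R (U ⧸ᴰ T) →
               Hom[ g ] (R ⊗ᴰ₀ W) U
  evalShiftᴰ {g = g} c d =
    reindex (evalShift g) ((d ⊗ᴰ₁ idᴰ) ⨾ᴰ ((idᴰ ⊗ᴰ₁ c) ⨾ᴰ evᴰˡ))

mainTheorem4 : ∀ {o h o' h' : Level}
    (𝕀 : MonoidalClosedCategory o h) (𝔼 : MonoidalClosedFibration 𝕀 o' h') →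
    let open MonoidalClosedCategory 𝕀
        open MonoidalClosedFibration 𝔼
    in ∀ {B C C' : Obj} (T : Ob[ B ]) (U : Ob[ C ]) (f : Hom C' C)
         (V : Pullback disp f U) →
       _≤_ disp (((shift B C) *) ((U ⧸ᴰ T) ⧹ᴰ U))
                (((shift B C') *) ((Pullback.obj V ⧸ᴰ T) ⧹ᴰ Pullback.obj V))
mainTheorem4 𝕀 𝔼 {B} {C} {C'} T U f V =
  subtypeOfPullback (fibration (shift B C') ((V' ⧸ᴰ T) ⧹ᴰ V')) (curryᴰˡ evalV)
  where
    open MonoidalClosedCategory 𝕀
    open MonoidalClosedFibration 𝔼
    open PullbackFactorisation disp
    open Residuals 𝕀 𝔼
    V' : Ob[ C' ]
    V' = Pullback.obj V
    W : Ob[ B ]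
    W = ((shift B C) *) ((U ⧸ᴰ T) ⧹ᴰ U)
    shiftedW : Hom[ shift B C ] W ((U ⧸ᴰ T) ⧹ᴰ U)
    shiftedW = Pullback.cart (fibration (shift B C) ((U ⧸ᴰ T) ⧹ᴰ U))
    evalU : Hom[ evʳ ⨾ f ] ((V' ⧸ᴰ T) ⊗ᴰ₀ W) U
    evalU = evalShiftᴰ shiftedW (postcompose⧸ T (Pullback.cart V))
    evalV : Hom[ evʳ ] ((V' ⧸ᴰ T) ⊗ᴰ₀ W) V'
    evalV = factorThrough V evʳ evalU
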